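{- Let $(X,\mathcal{C})$ be a convex geometry with closure operator $\phi$, let $x\in X$ and $Y\subseteq X$ with $x\notin Y$ and $x\in\phi(Y)$. Then a critical generator $A$ of $x$ with $\phi(A)\subseteq\phi(Y)$ can be computed using a number of calls to $\phi$ that is polynomial in $|X|$.
   Context: A closure system on a finite set $X$ is a family $\mathcal{C}\subseteq 2^X$ containing $X$ and closed under intersection, with closure operator $\phi(A)=\bigcap\{C\in\mathcal{C}:A\subseteq C\}$. It is a convex geometry if $\emptyset\in\mathcal{C}$ and for every $C\in\mathcal{C}$, $C\neq X$, there is $y\notin C$ with $C\cup\{y\}\in\mathcal{C}$. A minimal generator of $x$ is an inclusion-minimal $A\subseteq X\setminus\{x\}$ with $x\in\phi(A)$; it is a critical generator of $x$ if $\phi(A)\setminus\{a,x\}\in\mathcal{C}$ for every $a\in A$. The algorithm accesses $\phi$ as an oracle. -}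

module Defs where

open import Data.Nat using (ℕ; zero; suc; _+_; _*_; _^_; _≤_)
open import Data.Fin using (Fin)
open import Data.Fin.Subset
  using (Subset; _∈_; _∉_; _⊆_; _⊂_; _∩_; _∪_; _-_; ⊤; ⊥; ⁅_⁆; ⋂)
open import Data.Fin.Subset.Properties using (_⊆?_)
open import Data.List using (List; filter)
import Data.List.Membership.Propositional as L
open import Data.Product using (Σ; ∃; _×_; _,_; proj₁; proj₂)
open import Relation.Binary.PropositionalEquality using (_≡_; _≢_)

Family : ℕ → Set
Family n = List (Subset n)

_∈𝒞_ : ∀ {n} → Subset n → Family n → Set
C ∈𝒞 𝒞 = C L.∈ 𝒞

record IsClosureSystem {n : ℕ} (𝒞 : Family n) : Set where
  field
    has-X : ⊤ ∈𝒞 𝒞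
    ∩-closed : ∀ {C D} → C ∈𝒞 𝒞 → D ∈𝒞 𝒞 → (C ∩ D) ∈𝒞 𝒞

φ : ∀ {n} → Family n → Subset n → Subset n
φ 𝒞 A = ⋂ (filter (A ⊆?_) 𝒞)

record IsConvexGeometry {n : ℕ} (𝒞 : Family n) : Set where
  field
    closureSystem : IsClosureSystem 𝒞
    has-∅ : ⊥ ∈𝒞 𝒞
    anti-exchange-ext : ∀ {C} → C ∈𝒞 𝒞 → C ≢ ⊤ →
      ∃ λ (y : Fin n) → y ∉ C × (C ∪ ⁅ y ⁆) ∈𝒞 𝒞

record IsMinimalGenerator {n : ℕ} (𝒞 : Family n) (x : Fin n) (A : Subset n) : Set where
  field
    x∉A : x ∉ A
    generates : x ∈ φ 𝒞 A
    minimal : ∀ B → B ⊂ A → x ∉ φ 𝒞 B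

record IsCriticalGenerator {n : ℕ} (𝒞 : Family n) (x : Fin n) (A : Subset n) : Set where
  field
    minimalGenerator : IsMinimalGenerator 𝒞 x A
    critical : ∀ a → a ∈ A → (φ 𝒞 A - a - x) ∈𝒞 𝒞

-- Oracle algorithms: computations that may query the closure oracle
-- (Subset n → Subset n) and eventually return a value.
data Oracle (n : ℕ) (R : Set) : Set where
  return : R → Oracle n R
  query  : Subset n → (Subset n → Oracle n R) → Oracle n R

run : ∀ {n R} → (Subset n → Subset n) → Oracle n R → R
run o (return r) = r
run o (query S k) = run o (k (o S))

calls : ∀ {n R} → (Subset n → Subset n) → Oracle n R → ℕ
calls o (return r) = 0
calls o (query S k) = suc (calls o (k (o S)))

-- Starting from C = φ(Y), repeatedly delete from C an extreme point y (one with C - y closed)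
-- such that x ∈ φ(C - y - x) still holds; there are at most n rounds of 2n oracle calls.
-- When no such y is left, let A be the set of extreme points of C other than x. In a convex
-- geometry every closed set is the closure of its extreme points (the extension axiom yields
-- an extreme point outside any smaller closed set), and x is not extreme in C, so φ(A) = C.
-- The stopping condition gives x ∉ φ(C - a - x) for every a ∈ A: this makes C - a - x closed
-- (criticality) and keeps x out of the closure of every proper subset of A (minimality).

module Submission where

open import Defs
open import Data.Nat using (ℕ; _+_; _*_; _^_; _≤_)
open import Data.Fin using (Fin)
open import Data.Fin.Subset using (Subset; _∈_; _∉_; _⊆_)
open import Data.Product using (Σ; ∃; _×_)

open import Data.Bool using (true)
import Data.Bool.Properties as Bool
open import Data.Empty using (⊥-elim)
open import Data.Fin using (zero; suc; _≟_)
open import Data.Fin.Properties using (any?)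
open import Data.Fin.Subset using (_─_; _-_; _∪_; _∩_; ⁅_⁆; ∣_∣; _⊂_; _⊃_)
open import Data.Fin.Subset.Induction using (Acc; acc; ⊃-wellFounded)
open import Data.Fin.Subset.Properties
open import Data.List using ([]; _∷_)
import Data.List.Relation.Unary.Any as Any
open import Data.Nat using (zero; suc; z≤n; s≤s; _<_)
open import Data.Nat.Properties
  using (≤-trans; ≤-pred; +-identityʳ; <-≤-trans; m≤m*n; +-assoc; +-monoˡ-≤; +-monoʳ-≤; *-monoʳ-≤;
         module ≤-Reasoning)
open import Data.Nat.Tactic.RingSolver using (solve-∀)
open import Data.Product using (_,_; proj₁; proj₂)
open import Data.Sum using (_⊎_; inj₁; inj₂)
open import Data.Vec using (_∷_; there; tabulate)
open import Data.Vec.Functional using (Vector) renaming (_∷_ to _∷ᶠ_)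
open import Data.Vec.Properties using (≡-dec; lookup∘tabulate; []=⇒lookup; lookup⇒[]=)
open import Function using (_∘_; _$_)
open import Function.Bundles using (_⇔_; mk⇔; Equivalence)
open import Relation.Binary.PropositionalEquality
  using (_≡_; _≢_; refl; sym; trans; cong; cong₂; subst)
open import Relation.Nullary using (¬_; Dec; yes; no; does)
open import Relation.Nullary.Decidable using (_×-dec_; ¬?; dec-true; decidable-stable)
open import Relation.Unary using (Pred; Decidable)

open Equivalence using (to; from)

private
  variable
    n : ℕ

_≟ˢ_ : (p q : Subset n) → Dec (p ≡ q)
_≟ˢ_ = ≡-dec Bool._≟_

x∈p─q⇒x∉q : ∀ (p q : Subset n) {x} → x ∈ p ─ q → x ∉ q
x∈p─q⇒x∉q (_ ∷ p) (_ ∷ q) (there x∈p─q) (there x∈q) = x∈p─q⇒x∉q p q x∈p─q x∈q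

x∈p-y⇒x≢y : ∀ {p : Subset n} {x y} → x ∈ p - y → x ≢ y
x∈p-y⇒x≢y {p = p} {y = y} x∈p-y refl = x∈p─q⇒x∉q p ⁅ y ⁆ x∈p-y (x∈⁅x⁆ y)

⊆⊎∃∉ : (p q : Subset n) → p ⊆ q ⊎ ∃ λ z → z ∈ p × z ∉ q
⊆⊎∃∉ p q with any? (λ z → z ∈? p ×-dec ¬? (z ∈? q))
... | yes (z , z∈p , z∉q) = inj₂ (z , z∈p , z∉q)
... | no ∄z = inj₁ λ {z} z∈p → decidable-stable (z ∈? q) λ z∉q → ∄z (z , z∈p , z∉q)

p⊆q∪⁅y⁆⇒p-y≡p∩q : ∀ {p q : Subset n} {y} → y ∉ q → p ⊆ q ∪ ⁅ y ⁆ → p - y ≡ p ∩ q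
p⊆q∪⁅y⁆⇒p-y≡p∩q {p = p} {q} {y} y∉q p⊆q∪y = ⊆-antisym p-y⊆p∩q p∩q⊆p-y
  where
  p-y⊆p∩q : p - y ⊆ p ∩ q
  p-y⊆p∩q x∈p-y with p─q⊆p p ⁅ y ⁆ x∈p-y
  ... | x∈p with x∈p∪q⁻ q ⁅ y ⁆ (p⊆q∪y x∈p)
  ...   | inj₁ x∈q = x∈p∩q⁺ (x∈p , x∈q)
  ...   | inj₂ x∈y = ⊥-elim (x∈p-y⇒x≢y {p = p} x∈p-y (x∈⁅y⁆⇒x≡y y x∈y))
  p∩q⊆p-y : p ∩ q ⊆ p - y
  p∩q⊆p-y x∈p∩q with x∈p∩q⁻ p q x∈p∩q
  ... | x∈p , x∈q = x∈p∧x≢y⇒x∈p-y x∈p λ { refl → y∉q x∈q }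

subsetOf : ∀ {p} {P : Pred (Fin n) p} → Decidable P → Subset n
subsetOf P? = tabulate (does ∘ P?)

∈-subsetOf : ∀ {p} {P : Pred (Fin n) p} (P? : Decidable P) {x} → x ∈ subsetOf P? ⇔ P x
∈-subsetOf P? {x} = mk⇔ (witness (P? x) ∘ trans (sym (lookup∘tabulate _ x)) ∘ []=⇒lookup)
                        (lookup⇒[]= x _ ∘ trans (lookup∘tabulate _ x) ∘ dec-true (P? x))
  where
  witness : ∀ {a} {A : Set a} (a? : Dec A) → does a? ≡ true → A
  witness (yes a) _ = a

infixl 1 _>>=_
infixl 4 _<$>_

_>>=_ : ∀ {A B} → Oracle n A → (A → Oracle n B) → Oracle n B
return a  >>= k = k a
query S r >>= k = query S λ answer → r answer >>= k

_<$>_ : ∀ {A B} → (A → B) → Oracle n A → Oracle n B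
f <$> m = m >>= return ∘ f

queryAll : ∀ m → Vector (Subset n) m → Oracle n (Vector (Subset n) m)
queryAll zero    S = return λ ()
queryAll (suc m) S = query (S zero) λ answer → (answer ∷ᶠ_) <$> queryAll m (S ∘ suc)

module _ (o : Subset n → Subset n) where

  run->>= : ∀ {A B} (m : Oracle n A) (k : A → Oracle n B) → run o (m >>= k) ≡ run o (k (run o m))
  run->>= (return a)  k = refl
  run->>= (query S r) k = run->>= (r (o S)) k

  calls->>= : ∀ {A B} (m : Oracle n A) (k : A → Oracle n B) →
              calls o (m >>= k) ≡ calls o m + calls o (k (run o m))
  calls->>= (return a)  k = refl
  calls->>= (query S r) k = cong suc (calls->>= (r (o S)) k)

  run-<$> : ∀ {A B} (f : A → B) (m : Oracle n A) → run o (f <$> m) ≡ f (run o m)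
  run-<$> f m = run->>= m (return ∘ f)

  calls-<$> : ∀ {A B} (f : A → B) (m : Oracle n A) → calls o (f <$> m) ≡ calls o m
  calls-<$> f m = trans (calls->>= m (return ∘ f)) (+-identityʳ (calls o m))

  run-queryAll : ∀ m (S : Vector (Subset n) m) i → run o (queryAll m S) i ≡ o (S i)
  run-queryAll (suc m) S i =
    trans (cong (_$ i) (run-<$> (o (S zero) ∷ᶠ_) (queryAll m (S ∘ suc)))) (head-tail i)
    where
    head-tail : ∀ i → (o (S zero) ∷ᶠ run o (queryAll m (S ∘ suc))) i ≡ o (S i)
    head-tail zero    = refl
    head-tail (suc i) = run-queryAll m (S ∘ suc) i

  calls-queryAll : ∀ m (S : Vector (Subset n) m) → calls o (queryAll m S) ≡ m
  calls-queryAll zero    S = refl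
  calls-queryAll (suc m) S =
    cong suc (trans (calls-<$> _ (queryAll m (S ∘ suc))) (calls-queryAll m (S ∘ suc)))

-- D y and E y will be the oracle's answers φ(C - y) and φ(C - y - x), so D y ≡ C - y says
-- that C - y is closed.
removable? : (x : Fin n) (C : Subset n) (D E : Vector (Subset n) n) →
             Decidable λ y → (y ∈ C × D y ≡ C - y) × x ∈ E y
removable? x C D E y = ((y ∈? C) ×-dec (D y ≟ˢ (C - y))) ×-dec (x ∈? E y)

extremeBut? : (x : Fin n) (C : Subset n) (F : Vector (Subset n) n) →
              Decidable λ a → a ≢ x × (a ∈ C × F a ≡ C - a)
extremeBut? x C F a = ¬? (a ≟ x) ×-dec ((a ∈? C) ×-dec (F a ≟ˢ (C - a)))

shrinkStep : Fin n → (Subset n → Oracle n (Subset n)) →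
             (C : Subset n) (D E : Vector (Subset n) n) → Oracle n (Subset n)
shrinkStep x continue C D E with any? (removable? x C D E)
... | yes (y , _) = continue (C - y)
... | no _        = return C

shrink : Fin n → ℕ → Subset n → Oracle n (Subset n)
shrink x zero    C = return C
shrink x (suc f) C =
  queryAll _ (C -_) >>= λ D → queryAll _ (λ y → C - y - x) >>= λ E → shrinkStep x (shrink x f) C D E

extremePointsBut : Fin n → Subset n → Oracle n (Subset n)
extremePointsBut x C = (λ F → subsetOf (extremeBut? x C F)) <$> queryAll _ (C -_)

criticalGenerator : (n : ℕ) → Fin n → Subset n → Oracle n (Subset n)
criticalGenerator n x Y = query Y λ φY → shrink x (suc n) φY >>= extremePointsBut x

module _ (o : Subset n → Subset n) (x : Fin n) where

  answeredStep : ℕ → Subset n → Oracle n (Subset n)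
  answeredStep f C =
    shrinkStep x (shrink x f) C (run o (queryAll n (C -_))) (run o (queryAll n (λ y → C - y - x)))

  run-shrink-suc : ∀ f C → run o (shrink x (suc f) C) ≡ run o (answeredStep f C)
  run-shrink-suc f C =
    trans (run->>= o (queryAll n (C -_)) _) (run->>= o (queryAll n (λ y → C - y - x)) _)

  calls-shrink-suc : ∀ f C → calls o (shrink x (suc f) C) ≡ n + (n + calls o (answeredStep f C))
  calls-shrink-suc f C =
    trans (calls->>= o (queryAll n (C -_)) _)
          (cong₂ _+_ (calls-queryAll o n (C -_))
                     (trans (calls->>= o (queryAll n (λ y → C - y - x)) _)
                            (cong (_+ calls o (answeredStep f C)) (calls-queryAll o n _))))

  shrink-⊆ : ∀ f C → run o (shrink x f C) ⊆ C
  shrink-⊆ zero    C = ⊆-refl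
  shrink-⊆ (suc f) C rewrite run-shrink-suc f C = step-⊆ _ _
    where
    step-⊆ : ∀ D E → run o (shrinkStep x (shrink x f) C D E) ⊆ C
    step-⊆ D E with any? (removable? x C D E)
    ... | yes (y , _) = ⊆-trans (shrink-⊆ f (C - y)) (p─q⊆p C ⁅ y ⁆)
    ... | no _        = ⊆-refl

  calls-shrink : ∀ f C → calls o (shrink x f C) ≤ f * (n + n)
  calls-shrink zero    C = z≤n
  calls-shrink (suc f) C = begin
    calls o (shrink x (suc f) C)         ≡⟨ calls-shrink-suc f C ⟩
    n + (n + calls o (answeredStep f C)) ≤⟨ +-monoʳ-≤ n (+-monoʳ-≤ n (step-calls _ _)) ⟩
    n + (n + f * (n + n))                ≡⟨ +-assoc n n _ ⟨
    suc f * (n + n)                      ∎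
    where
    open ≤-Reasoning
    step-calls : ∀ D E → calls o (shrinkStep x (shrink x f) C D E) ≤ f * (n + n)
    step-calls D E with any? (removable? x C D E)
    ... | yes (y , _) = calls-shrink f (C - y)
    ... | no _        = z≤n

  calls-criticalGenerator : ∀ Y → calls o (criticalGenerator n x Y) ≤ suc (suc n * (n + n) + n)
  calls-criticalGenerator Y = s≤s (begin
    calls o (shrink x (suc n) (o Y) >>= extremePointsBut x)
      ≡⟨ calls->>= o (shrink x (suc n) (o Y)) _ ⟩
    calls o (shrink x (suc n) (o Y)) + calls o (extremePointsBut x _)
      ≡⟨ cong (calls o (shrink x (suc n) (o Y)) +_)
              (trans (calls-<$> o _ (queryAll n _)) (calls-queryAll o n _)) ⟩
    calls o (shrink x (suc n) (o Y)) + n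
      ≤⟨ +-monoˡ-≤ n (calls-shrink (suc n) (o Y)) ⟩
    suc n * (n + n) + n ∎)
    where open ≤-Reasoning

φ-extensive : ∀ (𝒞 : Family n) A → A ⊆ φ 𝒞 A
φ-extensive []      A = ⊆⊤
φ-extensive (C ∷ 𝒞) A with A ⊆? C
... | yes A⊆C = λ a∈A → x∈p∩q⁺ (A⊆C a∈A , φ-extensive 𝒞 A a∈A)
... | no _    = φ-extensive 𝒞 A

φ-least : ∀ {𝒞 : Family n} {A C} → C ∈𝒞 𝒞 → A ⊆ C → φ 𝒞 A ⊆ C
φ-least {𝒞 = D ∷ 𝒞} {A} (Any.here refl) A⊆C with A ⊆? D
... | yes _   = λ z∈ → proj₁ (x∈p∩q⁻ D _ z∈)
... | no A⊈D = ⊥-elim (A⊈D A⊆C)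
φ-least {𝒞 = D ∷ 𝒞} {A} (Any.there C∈𝒞) A⊆C with A ⊆? D
... | yes _ = λ z∈ → φ-least C∈𝒞 A⊆C (proj₂ (x∈p∩q⁻ D _ z∈))
... | no _  = φ-least C∈𝒞 A⊆C

module ClosureSystemProperties {𝒞 : Family n} (cs : IsClosureSystem 𝒞) where
  open IsClosureSystem cs

  φ-closed : ∀ A → φ 𝒞 A ∈𝒞 𝒞
  φ-closed A = ⋂-closed 𝒞 (λ C∈𝒞 → C∈𝒞)
    where
    ⋂-closed : ∀ 𝒟 → (∀ {C} → C ∈𝒞 𝒟 → C ∈𝒞 𝒞) → φ 𝒟 A ∈𝒞 𝒞
    ⋂-closed []      _   = has-X
    ⋂-closed (D ∷ 𝒟) 𝒟⊆𝒞 with A ⊆? D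
    ... | yes _ = ∩-closed (𝒟⊆𝒞 (Any.here refl)) (⋂-closed 𝒟 (𝒟⊆𝒞 ∘ Any.there))
    ... | no _  = ⋂-closed 𝒟 (𝒟⊆𝒞 ∘ Any.there)

  φ-monotone : ∀ {A B} → A ⊆ B → φ 𝒞 A ⊆ φ 𝒞 B
  φ-monotone {A} {B} A⊆B = φ-least (φ-closed B) (⊆-trans A⊆B (φ-extensive 𝒞 B))

  closed⇒φ-fixed : ∀ {C} → C ∈𝒞 𝒞 → φ 𝒞 C ≡ C
  closed⇒φ-fixed {C} C∈𝒞 = ⊆-antisym (φ-least C∈𝒞 ⊆-refl) (φ-extensive 𝒞 C)

  φ-fixed⇒closed : ∀ {C} → φ 𝒞 C ≡ C → C ∈𝒞 𝒞
  φ-fixed⇒closed {C} φC≡C = subst (_∈𝒞 𝒞) φC≡C (φ-closed C)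

  p-x∈𝒞 : ∀ {D x} → D ∈𝒞 𝒞 → x ∉ φ 𝒞 (D - x) → (D - x) ∈𝒞 𝒞
  p-x∈𝒞 {D} {x} D∈𝒞 x∉φ[D-x] =
    φ-fixed⇒closed (⊆-antisym φ[D-x]⊆D-x (φ-extensive 𝒞 (D - x)))
    where
    φ[D-x]⊆D-x : φ 𝒞 (D - x) ⊆ D - x
    φ[D-x]⊆D-x z∈ =
      x∈p∧x≢y⇒x∈p-y (φ-least D∈𝒞 (p─q⊆p D ⁅ x ⁆) z∈) λ { refl → x∉φ[D-x] z∈ }

module _ (𝒞 : Family n) where

  IsExtreme : Subset n → Fin n → Set
  IsExtreme C a = a ∈ C × (C - a) ∈𝒞 𝒞

  IsExtremePointsBut : Fin n → Subset n → Subset n → Set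
  IsExtremePointsBut x C A = ∀ a → a ∈ A ⇔ (a ≢ x × IsExtreme C a)

  record Generating (x : Fin n) (C : Subset n) : Set where
    field
      closed    : C ∈𝒞 𝒞
      generated : x ∈ φ 𝒞 (C - x)

  Reduced : Fin n → Subset n → Set
  Reduced x C = ∀ {y} → IsExtreme C y → x ∉ φ 𝒞 (C - y - x)

module ConvexGeometryProperties {𝒞 : Family n} (cg : IsConvexGeometry 𝒞) where
  open IsConvexGeometry cg
  open IsClosureSystem closureSystem
  open ClosureSystemProperties closureSystem

  extreme-point-outside : ∀ {K C z} → K ∈𝒞 𝒞 → C ∈𝒞 𝒞 → z ∈ C → z ∉ K →
                          ∃ λ y → y ∉ K × IsExtreme 𝒞 C y
  extreme-point-outside {K} {C} K∈𝒞 C∈𝒞 = go (⊃-wellFounded K) K∈𝒞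
    where
    -- Grow K one point at a time until C ⊆ K ∪ ⁅ y ⁆; then C - y = C ∩ K is closed.
    go : ∀ {K z} → Acc _⊃_ K → K ∈𝒞 𝒞 → z ∈ C → z ∉ K → ∃ λ y → y ∉ K × IsExtreme 𝒞 C y
    go {K} {z} (acc larger) K∈𝒞 z∈C z∉K with anti-exchange-ext K∈𝒞 (λ { refl → z∉K ∈⊤ })
    ... | y , y∉K , K+y∈𝒞 with ⊆⊎∃∉ C (K ∪ ⁅ y ⁆)
    ...   | inj₁ C⊆K+y = y , y∉K , y∈C (x∈p∪q⁻ K ⁅ y ⁆ (C⊆K+y z∈C)) , C-y∈𝒞
      where
      y∈C : z ∈ K ⊎ z ∈ ⁅ y ⁆ → y ∈ C
      y∈C (inj₁ z∈K) = ⊥-elim (z∉K z∈K)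
      y∈C (inj₂ z∈y) = subst (_∈ C) (x∈⁅y⁆⇒x≡y y z∈y) z∈C
      C-y∈𝒞 : (C - y) ∈𝒞 𝒞
      C-y∈𝒞 = subst (_∈𝒞 𝒞) (sym (p⊆q∪⁅y⁆⇒p-y≡p∩q y∉K C⊆K+y)) (∩-closed C∈𝒞 K∈𝒞)
    ...   | inj₂ (w , w∈C , w∉K+y) with go (larger K⊂K+y) K+y∈𝒞 w∈C w∉K+y
      where
      K⊂K+y : K ⊂ K ∪ ⁅ y ⁆
      K⊂K+y = p⊆p∪q ⁅ y ⁆ , y , x∈p∪q⁺ (inj₂ (x∈⁅x⁆ y)) , y∉K
    ...     | v , v∉K+y , v-extreme = v , v∉K+y ∘ p⊆p∪q ⁅ y ⁆ , v-extreme

  krein-milman : ∀ {C A} → C ∈𝒞 𝒞 → A ⊆ C → (∀ {a} → IsExtreme 𝒞 C a → a ∈ A) → φ 𝒞 A ≡ C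
  krein-milman {C} {A} C∈𝒞 A⊆C extreme⊆A = ⊆-antisym (φ-least C∈𝒞 A⊆C) C⊆φA
    where
    C⊆φA : C ⊆ φ 𝒞 A
    C⊆φA with ⊆⊎∃∉ C (φ 𝒞 A)
    ... | inj₁ C⊆φA = C⊆φA
    ... | inj₂ (z , z∈C , z∉φA) with extreme-point-outside (φ-closed A) C∈𝒞 z∈C z∉φA
    ...   | y , y∉φA , y-extreme = ⊥-elim (y∉φA (φ-extensive 𝒞 A (extreme⊆A y-extreme)))

  module _ {x C} (gen : Generating 𝒞 x C) where
    open Generating gen

    generating⇒∈ : x ∈ C
    generating⇒∈ = φ-least closed (p─q⊆p C ⁅ x ⁆) generated

    generating⇒¬extreme : ¬ IsExtreme 𝒞 C x
    generating⇒¬extreme (_ , C-x∈𝒞) = x∈p-y⇒x≢y {p = C} (φ-least C-x∈𝒞 ⊆-refl generated) refl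

    φ-extremePointsBut : ∀ {A} → IsExtremePointsBut 𝒞 x C A → φ 𝒞 A ≡ C
    φ-extremePointsBut {A} A≐ex =
      krein-milman closed (λ a∈A → proj₁ (proj₂ (to (A≐ex _) a∈A))) extreme⇒∈A
      where
      extreme⇒∈A : ∀ {a} → IsExtreme 𝒞 C a → a ∈ A
      extreme⇒∈A {a} a-extreme =
        from (A≐ex a) ((λ { refl → generating⇒¬extreme a-extreme }) , a-extreme)

    reduced⇒critical : ∀ {A} → Reduced 𝒞 x C → IsExtremePointsBut 𝒞 x C A →
                       IsCriticalGenerator 𝒞 x A
    reduced⇒critical {A} reduced A≐ex = record
      { minimalGenerator = record
        { x∉A       = λ x∈A → proj₁ (to (A≐ex x) x∈A) refl
        ; generates = subst (x ∈_) (sym φA≡C) generating⇒∈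
        ; minimal   = λ { B (B⊆A , a , a∈A , a∉B) x∈φB →
                            reduced (extreme a∈A) (φ-monotone (⊆C-a-x B⊆A a∉B) x∈φB) }
        }
      ; critical = λ a a∈A →
          subst (λ D → (D - a - x) ∈𝒞 𝒞) (sym φA≡C)
                (p-x∈𝒞 (proj₂ (extreme a∈A)) (reduced (extreme a∈A)))
      }
      where
      φA≡C : φ 𝒞 A ≡ C
      φA≡C = φ-extremePointsBut A≐ex
      extreme : ∀ {a} → a ∈ A → IsExtreme 𝒞 C a
      extreme a∈A = proj₂ (to (A≐ex _) a∈A)
      ⊆C-a-x : ∀ {B a} → B ⊆ A → a ∉ B → B ⊆ C - a - x
      ⊆C-a-x B⊆A a∉B {b} b∈B with to (A≐ex b) (B⊆A b∈B)
      ... | b≢x , b∈C , _ = x∈p∧x≢y⇒x∈p-y (x∈p∧x≢y⇒x∈p-y b∈C λ { refl → a∉B b∈B }) b≢x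

  generating-φ : ∀ {x Y} → x ∉ Y → x ∈ φ 𝒞 Y → Generating 𝒞 x (φ 𝒞 Y)
  generating-φ {x} {Y} x∉Y x∈φY = record
    { closed    = φ-closed Y
    ; generated = φ-monotone (λ y∈Y → x∈p∧x≢y⇒x∈p-y (φ-extensive 𝒞 Y y∈Y) λ { refl → x∉Y y∈Y }) x∈φY
    }

  shrink-correct : ∀ x f {C} → Generating 𝒞 x C → ∣ C ∣ < f →
                   let C′ = run (φ 𝒞) (shrink x f C) in Generating 𝒞 x C′ × Reduced 𝒞 x C′
  shrink-correct x (suc f) {C} gen ∣C∣<1+f rewrite run-shrink-suc (φ 𝒞) x f C =
    step _ _ (run-queryAll (φ 𝒞) n (C -_)) (run-queryAll (φ 𝒞) n (λ y → C - y - x))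
    where
    step : ∀ D E → (∀ y → D y ≡ φ 𝒞 (C - y)) → (∀ y → E y ≡ φ 𝒞 (C - y - x)) →
           let C′ = run (φ 𝒞) (shrinkStep x (shrink x f) C D E) in Generating 𝒞 x C′ × Reduced 𝒞 x C′
    step D E D≡φ E≡φ with any? (removable? x C D E)
    ... | yes (y , (y∈C , Dy≡C-y) , x∈Ey) =
          shrink-correct x f
            (record { closed    = φ-fixed⇒closed (trans (sym (D≡φ y)) Dy≡C-y)
                    ; generated = subst (x ∈_) (E≡φ y) x∈Ey
                    })
            (<-≤-trans (x∈p⇒∣p-x∣<∣p∣ y∈C) (≤-pred ∣C∣<1+f))
    ... | no irreducible =
          gen , λ { {y} (y∈C , C-y∈𝒞) x∈φ →
                    irreducible (y , (y∈C , trans (D≡φ y) (closed⇒φ-fixed C-y∈𝒞))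
                                   , subst (x ∈_) (sym (E≡φ y)) x∈φ) }

  extremePointsBut-correct : ∀ x C → IsExtremePointsBut 𝒞 x C (run (φ 𝒞) (extremePointsBut x C))
  extremePointsBut-correct x C a
    rewrite run-<$> (φ 𝒞) (subsetOf ∘ extremeBut? x C) (queryAll n (C -_)) =
    mk⇔ (λ a∈A → let a≢x , a∈C , Fa≡C-a = to (∈-subsetOf (extremeBut? x C F)) a∈A in
                 a≢x , a∈C , φ-fixed⇒closed (trans (sym (F≡φ a)) Fa≡C-a))
        (λ { (a≢x , a∈C , C-a∈𝒞) →
             from (∈-subsetOf (extremeBut? x C F)) (a≢x , a∈C , trans (F≡φ a) (closed⇒φ-fixed C-a∈𝒞)) })
    where
    F : Vector (Subset n) n
    F = run (φ 𝒞) (queryAll n (C -_))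
    F≡φ : ∀ a → F a ≡ φ 𝒞 (C - a)
    F≡φ = run-queryAll (φ 𝒞) n (C -_)

  criticalGenerator-correct : ∀ {x Y} → x ∉ Y → x ∈ φ 𝒞 Y →
    let A = run (φ 𝒞) (criticalGenerator n x Y) in IsCriticalGenerator 𝒞 x A × φ 𝒞 A ⊆ φ 𝒞 Y
  criticalGenerator-correct {x} {Y} x∉Y x∈φY
    rewrite run->>= (φ 𝒞) (shrink x (suc n) (φ 𝒞 Y)) (extremePointsBut x) =
    reduced⇒critical gen reduced A≐ex ,
    ⊆-trans (⊆-reflexive (φ-extremePointsBut gen A≐ex)) (shrink-⊆ (φ 𝒞) x (suc n) (φ 𝒞 Y))
    where
    C : Subset n
    C = run (φ 𝒞) (shrink x (suc n) (φ 𝒞 Y))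
    gen×reduced : Generating 𝒞 x C × Reduced 𝒞 x C
    gen×reduced = shrink-correct x (suc n) (generating-φ x∉Y x∈φY) (s≤s (∣p∣≤n (φ 𝒞 Y)))
    gen : Generating 𝒞 x C
    gen = proj₁ gen×reduced
    reduced : Reduced 𝒞 x C
    reduced = proj₂ gen×reduced
    A≐ex : IsExtremePointsBut 𝒞 x C (run (φ 𝒞) (extremePointsBut x C))
    A≐ex = extremePointsBut-correct x C

n≤n*n : ∀ n → n ≤ n * n
n≤n*n zero    = z≤n
n≤n*n (suc n) = m≤m*n (suc n) (suc n)

quadratic-bound : ∀ n → suc (suc n * (n + n) + n) ≤ 5 * n ^ 2 + 5
quadratic-bound n = begin
  suc (suc n * (n + n) + n)     ≡⟨ expand n ⟩
  2 * (n * n) + 3 * n + 1       ≤⟨ +-monoˡ-≤ 1 (+-monoʳ-≤ (2 * (n * n)) (*-monoʳ-≤ 3 (n≤n*n n))) ⟩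
  2 * (n * n) + 3 * (n * n) + 1 ≡⟨ collect n ⟩
  5 * n ^ 2 + 1                 ≤⟨ +-monoʳ-≤ (5 * n ^ 2) (s≤s z≤n) ⟩
  5 * n ^ 2 + 5                 ∎
  where
  open ≤-Reasoning
  expand : ∀ n → suc (suc n * (n + n) + n) ≡ 2 * (n * n) + 3 * n + 1
  expand = solve-∀
  -- n ^ 2 is written unfolded, since the ring solver does not reflect _^_.
  collect : ∀ n → 2 * (n * n) + 3 * (n * n) + 1 ≡ 5 * (n * (n * 1)) + 1
  collect = solve-∀

proposition6 : ∃ λ (c : ℕ) → ∃ λ (k : ℕ) →
    Σ ((n : ℕ) → Fin n → Subset n → Oracle n (Subset n)) λ alg →
      ∀ (n : ℕ) (𝒞 : Family n) → IsConvexGeometry 𝒞 →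
      ∀ (x : Fin n) (Y : Subset n) → x ∉ Y → x ∈ φ 𝒞 Y →
        IsCriticalGenerator 𝒞 x (run (φ 𝒞) (alg n x Y))
        × φ 𝒞 (run (φ 𝒞) (alg n x Y)) ⊆ φ 𝒞 Y
        × calls (φ 𝒞) (alg n x Y) ≤ c * n ^ k + c
proposition6 = 5 , 2 , criticalGenerator , λ n 𝒞 cg x Y x∉Y x∈φY →
  let critical , ⊆φY = ConvexGeometryProperties.criticalGenerator-correct cg x∉Y x∈φY
  in critical , ⊆φY , ≤-trans (calls-criticalGenerator (φ 𝒞) x Y) (quadratic-bound n)
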